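{- Let $G\sim{\sf G}(n,\tfrac12,k)$ with planted clique $K$, where $k\ge 2\log n$, and let $S$ be any subset of $K$ with $|S|\ge 2\log n$. Let $T$ be the set of all non-clique vertices (vertices not in $K$) that are adjacent to every vertex of $S$. Then, except with probability at most $\left(\tfrac1n\right)^{\log k}$, $|T|\le 3\log k$ (this holding simultaneously for all such $S$).
   Context: ${\sf G}(n,\tfrac12,k)$: on vertex set $[n]$, a set $K\subset[n]$ of size $k$ is chosen uniformly at random; all pairs inside $K$ are edges and all other pairs of distinct vertices are edges independently with probability $1/2$. Logarithms are base 2. -}

module Defs where

open import Data.Bool using (Bool; true; false; _∧_; _∨_; not; if_then_else_)
open import Data.Nat using (ℕ; zero; suc; _+_; _*_; _^_; _≤_; _<_; _≡ᵇ_)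
open import Data.Fin using (Fin; _≟_)
open import Data.Vec using (Vec; []; _∷_; lookup; tabulate)
open import Data.List using (List; []; _∷_; [_]; map; concatMap; length; filterᵇ; allFin; cartesianProduct)
open import Data.Bool.ListAction using (all; any)
open import Data.Product using (_×_; _,_; proj₁; proj₂)
open import Data.Fin.Subset using (Subset; ∣_∣)
open import Relation.Nullary.Decidable using (⌊_⌋)

allVecs : {A : Set} → List A → (m : ℕ) → List (Vec A m)
allVecs xs zero = [ [] ]
allVecs xs (suc m) = concatMap (λ x → map (x ∷_) (allVecs xs m)) xs

allSubsets : (n : ℕ) → List (Subset n)
allSubsets n = allVecs (true ∷ false ∷ []) n

Graph : ℕ → Set
Graph n = Vec (Vec Bool n) n

adj : {n : ℕ} → Graph n → Fin n → Fin n → Bool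
adj G i j = lookup (lookup G i) j

mem : {n : ℕ} → Fin n → Subset n → Bool
mem i S = lookup S i

_==_ : Bool → Bool → Bool
true == b = b
false == b = not b

isSimpleGraph : {n : ℕ} → Graph n → Bool
isSimpleGraph {n} G =
  all (λ i → not (adj G i i) ∧ all (λ j → adj G i j == adj G j i) (allFin n)) (allFin n)

allGraphs : (n : ℕ) → List (Graph n)
allGraphs n = filterᵇ isSimpleGraph (allVecs (allVecs (true ∷ false ∷ []) n) n)

isClique : {n : ℕ} → Graph n → Subset n → Bool
isClique {n} G K =
  all (λ i → all (λ j → not (mem i K ∧ mem j K ∧ not ⌊ i ≟ j ⌋) ∨ adj G i j) (allFin n)) (allFin n)

_⊆ᵇ_ : {n : ℕ} → Subset n → Subset n → Bool
_⊆ᵇ_ {n} S K = all (λ i → not (mem i S) ∨ mem i K) (allFin n)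

commonNbrsOutside : {n : ℕ} → Graph n → Subset n → Subset n → Subset n
commonNbrsOutside {n} G K S =
  tabulate (λ v → not (mem v K) ∧ all (λ u → not (mem u S) ∨ adj G v u) (allFin n))

-- Bad event: some S ⊆ K with |S| ≥ 2 log n (i.e. n^2 ≤ 2^|S|) has
-- |T(S)| > 3 log k (i.e. k^3 < 2^|T(S)|).
_≤ᵇ_ : ℕ → ℕ → Bool
zero ≤ᵇ m = true
suc n ≤ᵇ zero = false
suc n ≤ᵇ suc m = n ≤ᵇ m

badEvent : (n k : ℕ) → Graph n → Subset n → Bool
badEvent n k G K =
  any (λ S → (S ⊆ᵇ K) ∧ ((n ^ 2) ≤ᵇ (2 ^ ∣ S ∣))
             ∧ not ((2 ^ ∣ commonNbrsOutside G K S ∣) ≤ᵇ (k ^ 3)))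
      (allSubsets n)

-- Outcomes of G(n,1/2,k): pairs (K, G) with |K| = k and K a clique of G.
-- Given K (uniform among k-sets), G is uniform among graphs containing
-- the clique on K; the number of such G is the same for every K, so the
-- law of (K, G) is the uniform distribution on this finite list.
outcomes : (n k : ℕ) → List (Subset n × Graph n)
outcomes n k =
  filterᵇ (λ p → (∣ proj₁ p ∣ ≡ᵇ k) ∧ isClique (proj₂ p) (proj₁ p))
          (cartesianProduct (allSubsets n) (allGraphs n))

totalCount : (n k : ℕ) → ℕ
totalCount n k = length (outcomes n k)

badCount : (n k : ℕ) → ℕ
badCount n k = length (filterᵇ (λ p → badEvent n k (proj₂ p) (proj₁ p)) (outcomes n k))

-- "bad / total ≤ (1/n)^(log₂ k)", i.e. log₂(total/bad) ≥ log₂ n · log₂ k,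
-- expressed exactly via all rational lower bounds p/q ≤ log₂ n, r/s ≤ log₂ k
-- (2^p ≤ n^q, 2^r ≤ k^s):  bad^(qs) · 2^(pr) ≤ total^(qs).
ProbAtMostInvNPowLogK : (bad total n k : ℕ) → Set
ProbAtMostInvNPowLogK bad total n k =
  (p q r s : ℕ) → 1 ≤ q → 1 ≤ s → 2 ^ p ≤ n ^ q → 2 ^ r ≤ k ^ s →
  bad ^ (q * s) * 2 ^ (p * r) ≤ total ^ (q * s)

-- Counting by an injection. Put s₀ = ⌈log₂ n²⌉ and t₀ = ⌈log₂ (k³ + 1)⌉. In a bad outcome (K, G)
-- some S ⊆ K has at least s₀ elements and at least t₀ common neighbours outside K, so there are
-- distinct σ₁ … σ_{s₀} in K and distinct τ₁ … τ_{t₀} outside K with every edge σᵢτⱼ present.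
-- Overwriting these s₀t₀ edges by an arbitrary pattern P yields again an outcome, and
-- (K, G, P) ↦ (K, G[σ×τ := P], σ, τ) is injective because the overwritten edges were all present;
-- hence bad · 2^{s₀t₀} ≤ total · k^{s₀} n^{t₀}. Since n² ≤ 2^{s₀} and k³ ≤ 2^{t₀}, the factor
-- k^{s₀} n^{t₀} is at most 2^{(1/3 + 1/2) s₀t₀}, so bad/total ≤ 2^{-s₀t₀/6} ≤ 2^{-log n · log k}
-- (compared, for rational bounds p/q ≤ log n and r/s ≤ log k, after raising to the power q·s).

module Submission where

open import Defs
open import Data.Bool using (Bool; true; false; T; not; _∧_; _∨_)
open import Data.Bool.ListAction using (all; and; any)
open import Data.Bool.Properties using (T-≡; T-∧; T-not-≡)
open import Data.Fin using (Fin; zero; suc; _≟_)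
open import Data.Fin.Properties using (injective⇒≤)
open import Data.Fin.Subset using (Subset; ∣_∣; ⊥)
open import Data.List
  using (List; []; _∷_; map; concatMap; length; filterᵇ; allFin; cartesianProduct; cartesianProductWith; _++_)
import Data.List as List
open import Data.List.Properties using (length-map; length-++; length-tabulate; map-cong)
open import Data.List.Membership.Propositional using (_∈_)
open import Data.List.Membership.Propositional.Properties
  using (∈-lookup; ∈-map⁺; ∈-concatMap⁺; ∈-cartesianProductWith⁺; ∈-cartesianProduct⁺; ∈-cartesianProduct⁻; ∈-filter⁺; ∈-filter⁻; ∈-allFin)
import Data.List.Membership.Setoid.Properties as Membershipₛ
import Data.List.Relation.Unary.All as All
import Data.List.Relation.Unary.All.Properties as Allₚ
open import Data.List.Relation.Unary.Any as Any using (here; there; index)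
open import Data.List.Relation.Unary.AllPairs using ([]; _∷_)
open import Data.List.Relation.Unary.Unique.Propositional using (Unique)
import Data.List.Relation.Unary.Unique.Propositional.Properties as Unique
open import Data.Maybe as Maybe using (Maybe; just; nothing; _<∣>_; maybe′)
open import Data.Maybe.Properties using (<∣>-identityʳ; <∣>-idem)
open import Data.Nat using (ℕ; zero; suc; _+_; _*_; _^_; _≤_; _<_; z≤n; s≤s; _≡ᵇ_; NonZero; ⌊_/2⌋; ⌈_/2⌉)
open import Data.Nat.Induction using (<-wellFounded)
open import Data.Nat.Logarithm using (⌈log₂_⌉; ⌈log₂⌉-mono-≤; ⌈log₂2^n⌉≡n)
open import Data.Nat.Logarithm.Core using (⌈log2⌉)
open import Data.Nat.Properties
  using (⌊n/2⌋+⌈n/2⌉≡n; ⌊n/2⌋≤⌈n/2⌉; ⌈n/2⌉<n; +-monoʳ-≤; +-monoˡ-≤; *-monoʳ-≤; *-monoˡ-≤; *-mono-≤; *-assoc; *-comm;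
         *-identityʳ; *-cancelʳ-≤; ^-*-assoc; ^-monoˡ-≤; ^-monoˡ-<; ≮⇒≥; <⇒≱; <⇒≤; m^n≢0; m*n≢0; ≡ᵇ⇒≡; ≡⇒≡ᵇ;
         module ≤-Reasoning)
open import Data.Nat.Tactic.RingSolver using (solve-∀)
open import Data.Product using (_×_; _,_; proj₁; proj₂; uncurry)
open import Data.Sum as Sum using (_⊎_; inj₁; inj₂)
open import Data.Vec using (Vec; []; _∷_; lookup; tabulate)
open import Data.Vec.Properties using (lookup∘tabulate; tabulate∘lookup; tabulate-cong)
import Data.Vec.Relation.Unary.All.Properties as AllV
import Data.Vec.Relation.Unary.AllPairs as AllPairsV
import Data.Vec.Relation.Unary.Unique.Propositional as UniqueV
open import Function using (_∘_; id; Equivalence)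
open import Induction.WellFounded using (Acc; acc)
open import Relation.Binary.PropositionalEquality
open import Relation.Nullary using (¬_; yes; no; contradiction)
open import Relation.Nullary.Decidable using (T?; ⌊_⌋)

private variable
  A B C : Set
  m n s t : ℕ

-- Counting lists by injections

unique-lookup-injective : {xs : List A} → Unique xs → ∀ i j → List.lookup xs i ≡ List.lookup xs j → i ≡ j
unique-lookup-injective (_  ∷ _) zero    zero    _ = refl
unique-lookup-injective (x∉ ∷ _) zero    (suc j) e = contradiction e (All.lookup x∉ (∈-lookup j))
unique-lookup-injective (x∉ ∷ _) (suc i) zero    e = contradiction (sym e) (All.lookup x∉ (∈-lookup i))
unique-lookup-injective (_  ∷ u) (suc i) (suc j) e = cong suc (unique-lookup-injective u i j e)

injectiveOn⇒length≤ : {xs : List A} {ys : List B} → Unique xs → (f : A → B) →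
  (∀ {x} → x ∈ xs → f x ∈ ys) → (∀ {x y} → x ∈ xs → y ∈ xs → f x ≡ f y → x ≡ y) →
  length xs ≤ length ys
injectiveOn⇒length≤ {xs = xs} xs! f f∈ f-inj = injective⇒≤ {f = position} position-injective
  where
  position : Fin (length xs) → Fin _
  position i = index (f∈ (∈-lookup i))
  position-injective : ∀ {i j} → position i ≡ position j → i ≡ j
  position-injective {i} {j} e = unique-lookup-injective xs! i j (f-inj (∈-lookup i) (∈-lookup j)
    (Membershipₛ.index-injective (setoid _) (f∈ (∈-lookup i)) (f∈ (∈-lookup j)) e))

length-concatMap : (g : A → List B) (c : ℕ) (xs : List A) →
  (∀ {x} → x ∈ xs → length (g x) ≡ c) → length (concatMap g xs) ≡ length xs * c
length-concatMap g c []       _ = refl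
length-concatMap g c (x ∷ xs) h = trans (length-++ (g x))
  (cong₂ _+_ (h (here refl)) (length-concatMap g c xs (h ∘ there)))

length-cartesianProduct : (xs : List A) (ys : List B) →
  length (cartesianProduct xs ys) ≡ length xs * length ys
length-cartesianProduct []       ys = refl
length-cartesianProduct (x ∷ xs) ys = trans (length-++ (map (x ,_) ys))
  (cong₂ _+_ (length-map (x ,_) ys) (length-cartesianProduct xs ys))

dependentProduct : (xs : List A) → (A → List B) → List (A × B)
dependentProduct xs f = concatMap (λ x → map (x ,_) (f x)) xs

∈-dependentProduct⁺ : {xs : List A} {f : A → List B} {x : A} {y : B} →
  x ∈ xs → y ∈ f x → (x , y) ∈ dependentProduct xs f
∈-dependentProduct⁺ x∈ y∈ = ∈-concatMap⁺ _ (Any.map (λ { refl → ∈-map⁺ _ y∈ }) x∈)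

length-dependentProduct : (xs : List A) (f : A → List B) (c : ℕ) →
  (∀ {x} → x ∈ xs → length (f x) ≡ c) → length (dependentProduct xs f) ≡ length xs * c
length-dependentProduct xs f c h =
  length-concatMap _ c xs (λ {x} x∈ → trans (length-map (x ,_) (f x)) (h x∈))

firstOr : A → (A → Bool) → List A → A
firstOr d p []       = d
firstOr d p (x ∷ xs) with p x
... | true  = x
... | false = firstOr d p xs

firstOr-satisfies : (d : A) (p : A → Bool) (xs : List A) → T (any p xs) → T (p (firstOr d p xs))
firstOr-satisfies d p (x ∷ xs) h with p x in eq
... | true  = Equivalence.from T-≡ eq
... | false = firstOr-satisfies d p xs h

lookup-ext : {u v : Vec A m} → (∀ i → lookup u i ≡ lookup v i) → u ≡ v
lookup-ext {u = u} {v} h = trans (sym (tabulate∘lookup u)) (trans (tabulate-cong h) (tabulate∘lookup v))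

matrix-ext : {M N : Vec (Vec A t) s} → (∀ i j → lookup (lookup M i) j ≡ lookup (lookup N i) j) → M ≡ N
matrix-ext h = lookup-ext (λ i → lookup-ext (h i))

concatMap-map≡cartesianProductWith : (f : A → B → C) (xs : List A) (ys : List B) →
  concatMap (λ x → map (f x) ys) xs ≡ cartesianProductWith f xs ys
concatMap-map≡cartesianProductWith f []       ys = refl
concatMap-map≡cartesianProductWith f (x ∷ xs) ys =
  cong (map (f x) ys ++_) (concatMap-map≡cartesianProductWith f xs ys)

allVecs-suc : (xs : List A) (m : ℕ) → allVecs xs (suc m) ≡ cartesianProductWith _∷_ xs (allVecs xs m)
allVecs-suc xs m = concatMap-map≡cartesianProductWith _∷_ xs (allVecs xs m)

length-allVecs : (xs : List A) (m : ℕ) → length (allVecs xs m) ≡ length xs ^ m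
length-allVecs xs zero    = refl
length-allVecs xs (suc m) = length-concatMap _ _ xs
  (λ {x} _ → trans (length-map (x ∷_) (allVecs xs m)) (length-allVecs xs m))

allVecs-unique : {xs : List A} (m : ℕ) → Unique xs → Unique (allVecs xs m)
allVecs-unique zero    _   = All.[] ∷ []
allVecs-unique {xs = xs} (suc m) xs! = subst Unique (sym (allVecs-suc xs m))
  (Unique.cartesianProductWith⁺ _∷_ (λ { refl → refl , refl }) xs! (allVecs-unique m xs!))

∈-allVecs : (xs : List A) (v : Vec A m) → (∀ i → lookup v i ∈ xs) → v ∈ allVecs xs m
∈-allVecs xs []      _ = here refl
∈-allVecs {m = suc m} xs (x ∷ v) h = subst (x ∷ v ∈_) (sym (allVecs-suc xs m))
  (∈-cartesianProductWith⁺ _∷_ (h zero) (∈-allVecs xs v (h ∘ suc)))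

booleans-unique : Unique (true ∷ false ∷ [])
booleans-unique = ((λ ()) All.∷ All.[]) ∷ All.[] ∷ []

∈-booleans : (b : Bool) → b ∈ true ∷ false ∷ []
∈-booleans true  = here refl
∈-booleans false = there (here refl)

allSubsets-unique : (n : ℕ) → Unique (allSubsets n)
allSubsets-unique n = allVecs-unique n booleans-unique

∈-allSubsets : (S : Subset n) → S ∈ allSubsets n
∈-allSubsets S = ∈-allVecs _ S (∈-booleans ∘ lookup S)

length-allSubsets : (n : ℕ) → length (allSubsets n) ≡ 2 ^ n
length-allSubsets = length-allVecs (true ∷ false ∷ [])

takeOr : A → (m : ℕ) → List A → Vec A m
takeOr d zero    xs       = []
takeOr d (suc m) []       = d ∷ takeOr d m []
takeOr d (suc m) (x ∷ xs) = x ∷ takeOr d m xs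

lookup-takeOr-∈ : (d : A) {xs : List A} → m ≤ length xs → ∀ i → lookup (takeOr d m xs) i ∈ xs
lookup-takeOr-∈ d {x ∷ xs} (s≤s _) zero    = here refl
lookup-takeOr-∈ d {x ∷ xs} (s≤s m≤) (suc i) = there (lookup-takeOr-∈ d m≤ i)

takeOr-unique : (d : A) {xs : List A} → Unique xs → m ≤ length xs → UniqueV.Unique (takeOr d m xs)
takeOr-unique {m = zero}  d _          _        = AllPairsV.[]
takeOr-unique {m = suc m} d (x∉ ∷ xs!) (s≤s m≤) =
  AllV.lookup⁻ (λ i → All.lookup x∉ (lookup-takeOr-∈ d m≤ i)) AllPairsV.∷ takeOr-unique d xs! m≤

indexOf : Vec (Fin n) m → Fin n → Maybe (Fin m)
indexOf []      u = nothing
indexOf (x ∷ σ) u with x ≟ u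
... | yes _ = just zero
... | no  _ = Maybe.map suc (indexOf σ u)

indexOf-sound : (σ : Vec (Fin n) m) {u : Fin n} {i : Fin m} → indexOf σ u ≡ just i → lookup σ i ≡ u
indexOf-sound (x ∷ σ) {u} e with x ≟ u
indexOf-sound (x ∷ σ) refl | yes x≡u = x≡u
indexOf-sound (x ∷ σ) {u} e | no _ with indexOf σ u in eq
indexOf-sound (x ∷ σ) refl | no _ | just j = indexOf-sound σ eq

indexOf-lookup : {σ : Vec (Fin n) m} → UniqueV.Unique σ → ∀ i → indexOf σ (lookup σ i) ≡ just i
indexOf-lookup {σ = x ∷ σ} (x∉ AllPairsV.∷ σ!) zero with x ≟ x
... | yes _   = refl
... | no  x≢x = contradiction refl x≢x
indexOf-lookup {σ = x ∷ σ} (x∉ AllPairsV.∷ σ!) (suc i) with x ≟ lookup σ i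
... | yes x≡ = contradiction x≡ (AllV.lookup⁺ x∉ i)
... | no  _  = cong (Maybe.map suc) (indexOf-lookup σ! i)

indexOf-nothing : (σ : Vec (Fin n) m) {u : Fin n} → (∀ i → lookup σ i ≢ u) → indexOf σ u ≡ nothing
indexOf-nothing σ {u} h with indexOf σ u in eq
... | nothing = refl
... | just i  = contradiction (indexOf-sound σ eq) (h i)

elements : Subset n → List (Fin n)
elements {n} S = filterᵇ (λ i → mem i S) (allFin n)

elements-unique : (S : Subset n) → Unique (elements S)
elements-unique {n} S = Unique.filter⁺ (T? ∘ λ i → mem i S) (Unique.allFin⁺ n)

∈-elements⁺ : (S : Subset n) {i : Fin n} → T (mem i S) → i ∈ elements S
∈-elements⁺ S = ∈-filter⁺ (T? ∘ λ i → mem i S) (∈-allFin _)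

∈-elements⁻ : (S : Subset n) {i : Fin n} → i ∈ elements S → T (mem i S)
∈-elements⁻ {n} S = proj₂ ∘ ∈-filter⁻ (T? ∘ λ i → mem i S) {xs = allFin n}

length-filter-tabulate : (p : A → Bool) (f : Fin n → A) →
  length (filterᵇ p (List.tabulate f)) ≡ ∣ tabulate (p ∘ f) ∣
length-filter-tabulate {n = zero}  p f = refl
length-filter-tabulate {n = suc n} p f with p (f zero)
... | true  = cong suc (length-filter-tabulate p (f ∘ suc))
... | false = length-filter-tabulate p (f ∘ suc)

length-elements : (S : Subset n) → length (elements S) ≡ ∣ S ∣
length-elements S = trans (length-filter-tabulate (λ i → mem i S) id) (cong ∣_∣ (tabulate∘lookup S))

n≤2^⌈log₂n⌉ : ∀ n → n ≤ 2 ^ ⌈log₂ n ⌉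
n≤2^⌈log₂n⌉ n = bound n (<-wellFounded n)
  where
  bound : ∀ n (rec : Acc _<_ n) → n ≤ 2 ^ ⌈log2⌉ n rec
  bound 0             _        = z≤n
  bound 1             _        = s≤s z≤n
  bound (suc (suc n)) (acc rs) = begin
    2 + n                                        ≡⟨ cong (2 +_) (sym (⌊n/2⌋+⌈n/2⌉≡n n)) ⟩
    2 + (⌊ n /2⌋ + ⌈ n /2⌉)                        ≤⟨ +-monoʳ-≤ 2 (+-monoˡ-≤ ⌈ n /2⌉ (⌊n/2⌋≤⌈n/2⌉ n)) ⟩
    2 + (⌈ n /2⌉ + ⌈ n /2⌉)                        ≡⟨ double-suc ⌈ n /2⌉ ⟩
    2 * suc ⌈ n /2⌉                                ≤⟨ *-monoʳ-≤ 2 (bound (suc ⌈ n /2⌉) (rs (⌈n/2⌉<n n))) ⟩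
    2 * 2 ^ ⌈log2⌉ (suc ⌈ n /2⌉) (rs (⌈n/2⌉<n n))  ∎
    where
    open ≤-Reasoning
    double-suc : ∀ c → 2 + (c + c) ≡ 2 * suc c
    double-suc = solve-∀

⌈log₂⌉-least : ∀ {m x} → m ≤ 2 ^ x → ⌈log₂ m ⌉ ≤ x
⌈log₂⌉-least {x = x} m≤ = subst (_ ≤_) (⌈log₂2^n⌉≡n x) (⌈log₂⌉-mono-≤ m≤)

T-∧₃ : ∀ {a b c} → T (a ∧ b ∧ c) → T a × T b × T c
T-∧₃ {true} {true} {true} _ = _ , _ , _

T-all-allFin⁻ : (f : Fin n → Bool) → T (all f (allFin n)) → ∀ i → T (f i)
T-all-allFin⁻ {n} f h i = All.lookup (Allₚ.all⁺ f (allFin n) h) (∈-allFin i)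

T-all-allFin⁺ : (f : Fin n → Bool) → (∀ i → T (f i)) → T (all f (allFin n))
T-all-allFin⁺ {n} f h = Allₚ.all⁻ f {xs = allFin n} (All.tabulate (λ {i} _ → h i))

T-not-∨ : ∀ {a b} → T (not a ∨ b) → T a → T b
T-not-∨ {true} h _ = h

==⇒≡ : ∀ {a b} → T (a == b) → a ≡ b
==⇒≡ {true}  {true}  _ = refl
==⇒≡ {false} {false} _ = refl

==-refl : ∀ a → T (a == a)
==-refl true  = _
==-refl false = _

≤ᵇ⇒≤ : ∀ a b → T (a ≤ᵇ b) → a ≤ b
≤ᵇ⇒≤ zero    b       _ = z≤n
≤ᵇ⇒≤ (suc a) (suc b) h = s≤s (≤ᵇ⇒≤ a b h)

not-≤ᵇ⇒> : ∀ a b → T (not (a ≤ᵇ b)) → b < a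
not-≤ᵇ⇒> (suc a) zero    _ = s≤s z≤n
not-≤ᵇ⇒> (suc a) (suc b) h = s≤s (not-≤ᵇ⇒> a b h)

Loopless : Graph n → Set
Loopless G = ∀ i → adj G i i ≡ false

Symmetric : Graph n → Set
Symmetric G = ∀ i j → adj G i j ≡ adj G j i

isSimpleGraph⁻ : (G : Graph n) → T (isSimpleGraph G) → Loopless G × Symmetric G
isSimpleGraph⁻ G h = (λ i → Equivalence.to T-not-≡ (proj₁ (row i)))
                   , (λ i j → ==⇒≡ (T-all-allFin⁻ _ (proj₂ (row i)) j))
  where
  row : ∀ i → T (not (adj G i i)) × T (all (λ j → adj G i j == adj G j i) (allFin _))
  row i = Equivalence.to T-∧ (T-all-allFin⁻ _ h i)

isSimpleGraph⁺ : (G : Graph n) → Loopless G → Symmetric G → T (isSimpleGraph G)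
isSimpleGraph⁺ G loopless symmetric = T-all-allFin⁺ _ λ i → Equivalence.from T-∧
  ( Equivalence.from T-not-≡ (loopless i)
  , T-all-allFin⁺ _ (λ j → subst (λ b → T (adj G i j == b)) (symmetric i j) (==-refl (adj G i j))))

⊆ᵇ⇒⊆ : (S K : Subset n) → T (S ⊆ᵇ K) → ∀ {i} → T (mem i S) → T (mem i K)
⊆ᵇ⇒⊆ S K h {i} = T-not-∨ (T-all-allFin⁻ _ h i)

clique-entry-cong : ∀ a b c {x y} → (T a → T b → x ≡ y) → (not (a ∧ b ∧ c) ∨ x) ≡ (not (a ∧ b ∧ c) ∨ y)
clique-entry-cong true  true  c h = cong (not c ∨_) (h _ _)
clique-entry-cong true  false c h = refl
clique-entry-cong false b     c h = refl

isClique-cong : (G H : Graph n) (K : Subset n) →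
  (∀ i j → T (mem i K) → T (mem j K) → adj G i j ≡ adj H i j) → isClique G K ≡ isClique H K
isClique-cong {n} G H K h = cong and (map-cong (λ i → cong and (map-cong (λ j →
  clique-entry-cong (mem i K) (mem j K) (not ⌊ i ≟ j ⌋) (h i j)) (allFin n))) (allFin n))

∈-commonNbrsOutside⁻ : (G : Graph n) (K S : Subset n) {v : Fin n} → T (mem v (commonNbrsOutside G K S)) →
  ¬ T (mem v K) × (∀ {u} → T (mem u S) → T (adj G v u))
∈-commonNbrsOutside⁻ G K S {v} h = (λ v∈K → subst T (Equivalence.to T-not-≡ (proj₁ v∈T)) v∈K)
                                , (λ {u} → T-not-∨ (T-all-allFin⁻ _ (proj₂ v∈T) u))
  where
  v∈T : T (not (mem v K)) × T (all (λ u → not (mem u S) ∨ adj G v u) (allFin _))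
  v∈T = Equivalence.to T-∧ (subst T (lookup∘tabulate _ v) h)

-- Overwriting the edges between two vertex sequences

<∣>-comm-nothing : {a b : Maybe A} → a ≡ nothing ⊎ b ≡ nothing → a <∣> b ≡ b <∣> a
<∣>-comm-nothing {b = b} (inj₁ refl) = sym (<∣>-identityʳ b)
<∣>-comm-nothing {a = a} (inj₂ refl) = <∣>-identityʳ a

<∣>-just : (a b : Maybe A) {x : A} → a <∣> b ≡ just x → a ≡ just x ⊎ b ≡ just x
<∣>-just (just _) b e = inj₁ e
<∣>-just nothing  b e = inj₂ e

zip-nothing : {a : Maybe A} {b : Maybe B} → a ≡ nothing ⊎ b ≡ nothing → Maybe.zip a b ≡ nothing
zip-nothing               (inj₁ refl) = refl
zip-nothing {a = just _}  (inj₂ refl) = refl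
zip-nothing {a = nothing} (inj₂ refl) = refl

zip-just : (a : Maybe A) (b : Maybe B) {x : A} {y : B} → Maybe.zip a b ≡ just (x , y) → a ≡ just x × b ≡ just y
zip-just (just _) (just _) refl = refl , refl

module Overwrite {s t : ℕ} (σ : Vec (Fin n) s) (τ : Vec (Fin n) t) where

  slot : Fin n → Fin n → Maybe (Fin s × Fin t)
  slot u v = Maybe.zip (indexOf σ u) (indexOf τ v) <∣> Maybe.zip (indexOf σ v) (indexOf τ u)

  overwrite : Graph n → (Fin s → Fin t → Bool) → Graph n
  overwrite G P = tabulate λ u → tabulate λ v → maybe′ (uncurry P) (adj G u v) (slot u v)

  adj-overwrite : ∀ G P u v → adj (overwrite G P) u v ≡ maybe′ (uncurry P) (adj G u v) (slot u v)
  adj-overwrite G P u v = trans (cong (λ row → lookup row v) (lookup∘tabulate _ u)) (lookup∘tabulate _ v)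

  overwrite-overwrite : ∀ G P Q → overwrite (overwrite G P) Q ≡ overwrite G Q
  overwrite-overwrite G P Q = matrix-ext λ u v → begin
    adj (overwrite (overwrite G P) Q) u v                       ≡⟨ adj-overwrite (overwrite G P) Q u v ⟩
    maybe′ (uncurry Q) (adj (overwrite G P) u v) (slot u v)     ≡⟨ cong (λ b → maybe′ (uncurry Q) b (slot u v)) (adj-overwrite G P u v) ⟩
    maybe′ (uncurry Q) (maybe′ (uncurry P) (adj G u v) (slot u v)) (slot u v) ≡⟨ overwritten-twice (slot u v) ⟩
    maybe′ (uncurry Q) (adj G u v) (slot u v)                   ≡⟨ adj-overwrite G Q u v ⟨
    adj (overwrite G Q) u v                                     ∎
    where
    open ≡-Reasoning
    overwritten-twice : ∀ {b} m → maybe′ (uncurry Q) (maybe′ (uncurry P) b m) m ≡ maybe′ (uncurry Q) b m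
    overwritten-twice (just _) = refl
    overwritten-twice nothing  = refl

  slot-just : ∀ {u v i j} → slot u v ≡ just (i , j) →
    (lookup σ i ≡ u × lookup τ j ≡ v) ⊎ (lookup σ i ≡ v × lookup τ j ≡ u)
  slot-just {u} {v} e = Sum.map sound sound (<∣>-just _ _ e)
    where
    sound : ∀ {a b i j} → Maybe.zip (indexOf σ a) (indexOf τ b) ≡ just (i , j) → lookup σ i ≡ a × lookup τ j ≡ b
    sound e with zip-just _ _ e
    ... | eσ , eτ = indexOf-sound σ eσ , indexOf-sound τ eτ

  overwrite-self : ∀ {G P} → (∀ i j → adj G (lookup σ i) (lookup τ j) ≡ P i j) →
    (∀ i j → adj G (lookup τ j) (lookup σ i) ≡ P i j) → overwrite G P ≡ G
  overwrite-self {G} {P} στ τσ = matrix-ext λ u v → trans (adj-overwrite G P u v) (entry u v)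
    where
    entry : ∀ u v → maybe′ (uncurry P) (adj G u v) (slot u v) ≡ adj G u v
    entry u v with slot u v in e
    ... | nothing = refl
    ... | just (i , j) with slot-just e
    ...   | inj₁ (refl , refl) = sym (στ i j)
    ...   | inj₂ (refl , refl) = sym (τσ i j)

  module _ (σ! : UniqueV.Unique σ) (τ! : UniqueV.Unique τ) where

    slot-lookup : ∀ i j → slot (lookup σ i) (lookup τ j) ≡ just (i , j)
    slot-lookup i j rewrite indexOf-lookup σ! i | indexOf-lookup τ! j = refl

    adj-overwrite-lookup : ∀ G P i j → adj (overwrite G P) (lookup σ i) (lookup τ j) ≡ P i j
    adj-overwrite-lookup G P i j =
      trans (adj-overwrite G P _ _) (cong (maybe′ (uncurry P) _) (slot-lookup i j))

  adj-overwrite-outside : ∀ G P {u v} → (∀ j → lookup τ j ≢ u) → (∀ j → lookup τ j ≢ v) →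
    adj (overwrite G P) u v ≡ adj G u v
  adj-overwrite-outside G P {u} {v} u∉ v∉ = trans (adj-overwrite G P u v) (cong (maybe′ (uncurry P) _)
    (cong₂ _<∣>_ (zip-nothing {a = indexOf σ u} (inj₂ (indexOf-nothing τ v∉)))
                 (zip-nothing {a = indexOf σ v} (inj₂ (indexOf-nothing τ u∉)))))

  module _ (disjoint : ∀ i j → lookup σ i ≢ lookup τ j) where

    not-in-both : ∀ u → indexOf σ u ≡ nothing ⊎ indexOf τ u ≡ nothing
    not-in-both u with indexOf σ u in eσ
    ... | nothing = inj₁ refl
    ... | just i  = inj₂ (indexOf-nothing τ λ j eτ → disjoint i j (trans (indexOf-sound σ eσ) (sym eτ)))

    slot-sym : ∀ u v → slot u v ≡ slot v u
    slot-sym u v = <∣>-comm-nothing (Sum.map (zip-nothing ∘ inj₁) (zip-nothing ∘ inj₂) (not-in-both u))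

    slot-diag : ∀ u → slot u u ≡ nothing
    slot-diag u = trans (<∣>-idem _) (zip-nothing (not-in-both u))

    overwrite-loopless : ∀ {G} P → Loopless G → Loopless (overwrite G P)
    overwrite-loopless {G} P loopless u =
      trans (adj-overwrite G P u u) (trans (cong (maybe′ (uncurry P) _) (slot-diag u)) (loopless u))

    overwrite-symmetric : ∀ {G} P → Symmetric G → Symmetric (overwrite G P)
    overwrite-symmetric {G} P symmetric u v = begin
      adj (overwrite G P) u v                   ≡⟨ adj-overwrite G P u v ⟩
      maybe′ (uncurry P) (adj G u v) (slot u v) ≡⟨ cong₂ (maybe′ (uncurry P)) (symmetric u v) (slot-sym u v) ⟩
      maybe′ (uncurry P) (adj G v u) (slot v u) ≡⟨ adj-overwrite G P v u ⟨
      adj (overwrite G P) v u                   ∎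
      where open ≡-Reasoning

-- Encoding bad outcomes

record Biclique (G : Graph n) (K : Subset n) (σ : Vec (Fin n) s) (τ : Vec (Fin n) t) : Set where
  field
    inside   : ∀ i → T (mem (lookup σ i) K)
    outside  : ∀ j → ¬ T (mem (lookup τ j) K)
    joined   : ∀ i j → T (adj G (lookup τ j) (lookup σ i))
    σ-unique : UniqueV.Unique σ
    τ-unique : UniqueV.Unique τ

  disjoint : ∀ i j → lookup σ i ≢ lookup τ j
  disjoint i j e = outside j (subst (λ v → T (mem v K)) e (inside i))

  τ-avoids : ∀ {u} → T (mem u K) → ∀ j → lookup τ j ≢ u
  τ-avoids u∈K j e = outside j (subst (λ v → T (mem v K)) (sym e) u∈K)

biclique-of-commonNbrsOutside : (v₀ : Fin n) (G : Graph n) (K S : Subset n) →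
  (∀ {u} → T (mem u S) → T (mem u K)) → s ≤ ∣ S ∣ → t ≤ ∣ commonNbrsOutside G K S ∣ →
  Biclique G K (takeOr v₀ s (elements S)) (takeOr v₀ t (elements (commonNbrsOutside G K S)))
biclique-of-commonNbrsOutside {s = s} {t} v₀ G K S S⊆K s≤ t≤ = record
  { inside   = λ i → S⊆K (σ∈S i)
  ; outside  = λ j → proj₁ (τ∈N j)
  ; joined   = λ i j → proj₂ (τ∈N j) (σ∈S i)
  ; σ-unique = takeOr-unique v₀ (elements-unique S) s≤′
  ; τ-unique = takeOr-unique v₀ (elements-unique N) t≤′
  }
  where
  N : Subset _
  N = commonNbrsOutside G K S
  s≤′ : s ≤ length (elements S)
  s≤′ = subst (s ≤_) (sym (length-elements S)) s≤
  t≤′ : t ≤ length (elements N)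
  t≤′ = subst (t ≤_) (sym (length-elements N)) t≤
  σ∈S : ∀ i → T (mem (lookup (takeOr v₀ s (elements S)) i) S)
  σ∈S i = ∈-elements⁻ S (lookup-takeOr-∈ v₀ s≤′ i)
  τ∈N : ∀ j → let v = lookup (takeOr v₀ t (elements N)) j in ¬ T (mem v K) × (∀ {u} → T (mem u S) → T (adj G v u))
  τ∈N j = ∈-commonNbrsOutside⁻ G K S (∈-elements⁻ N (lookup-takeOr-∈ v₀ t≤′ j))

biclique-restore : ∀ {G : Graph n} {K} {σ : Vec (Fin n) s} {τ : Vec (Fin n) t} →
  Biclique G K σ τ → Symmetric G → Overwrite.overwrite σ τ G (λ _ _ → true) ≡ G
biclique-restore {σ = σ} {τ} b symmetric = Overwrite.overwrite-self σ τ
  (λ i j → trans (symmetric _ _) (Equivalence.to T-≡ (Biclique.joined b i j)))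
  (λ i j → Equivalence.to T-≡ (Biclique.joined b i j))

overwrite-injective : ∀ {G G′ : Graph n} {K K′} {σ σ′ : Vec (Fin n) s} {τ τ′ : Vec (Fin n) t} {P P′} →
  Biclique G K σ τ → Biclique G′ K′ σ′ τ′ → Symmetric G → Symmetric G′ → σ ≡ σ′ → τ ≡ τ′ →
  Overwrite.overwrite σ τ G P ≡ Overwrite.overwrite σ′ τ′ G′ P′ → G ≡ G′ × (∀ i j → P i j ≡ P′ i j)
overwrite-injective {G = G} {G′} {σ = σ} {τ = τ} {P = P} {P′ = P′} b b′ sym-G sym-G′ refl refl e =
  (begin
    G                                          ≡⟨ biclique-restore b sym-G ⟨
    overwrite G true₂                          ≡⟨ overwrite-overwrite G P true₂ ⟨
    overwrite (overwrite G P) true₂            ≡⟨ cong (λ H → overwrite H true₂) e ⟩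
    overwrite (overwrite G′ P′) true₂          ≡⟨ overwrite-overwrite G′ P′ true₂ ⟩
    overwrite G′ true₂                         ≡⟨ biclique-restore b′ sym-G′ ⟩
    G′                                         ∎)
  , λ i j → begin
    P i j                                      ≡⟨ adj-overwrite-lookup σ! τ! G P i j ⟨
    adj (overwrite G P) (lookup σ i) (lookup τ j)   ≡⟨ cong (λ H → adj H (lookup σ i) (lookup τ j)) e ⟩
    adj (overwrite G′ P′) (lookup σ i) (lookup τ j) ≡⟨ adj-overwrite-lookup σ! τ! G′ P′ i j ⟩
    P′ i j                                     ∎
  where
  open Overwrite σ τ
  open ≡-Reasoning
  true₂ : Fin _ → Fin _ → Bool
  true₂ _ _ = true
  σ! : UniqueV.Unique σ
  σ! = Biclique.σ-unique b
  τ! : UniqueV.Unique τ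
  τ! = Biclique.τ-unique b

record IsOutcome (k : ℕ) (K : Subset n) (G : Graph n) : Set where
  field
    size   : ∣ K ∣ ≡ k
    clique : T (isClique G K)
    simple : T (isSimpleGraph G)

  loopless : Loopless G
  loopless = proj₁ (isSimpleGraph⁻ G simple)

  symmetric : Symmetric G
  symmetric = proj₂ (isSimpleGraph⁻ G simple)

∈-outcomes⁻ : ∀ {k} {K : Subset n} {G} → (K , G) ∈ outcomes n k → IsOutcome k K G
∈-outcomes⁻ {n} {k} {K} {G} o∈
  with o∈pairs , size∧clique ← ∈-filter⁻ (T? ∘ _) o∈
  with _ , G∈ ← ∈-cartesianProduct⁻ (allSubsets n) (allGraphs n) o∈pairs
  with size , clique ← Equivalence.to T-∧ size∧clique
  = record
  { size   = ≡ᵇ⇒≡ ∣ K ∣ k size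
  ; clique = clique
  ; simple = proj₂ (∈-filter⁻ (T? ∘ isSimpleGraph) {xs = allVecs (allSubsets n) n} G∈)
  }

∈-outcomes⁺ : ∀ {k} {K : Subset n} {G} → IsOutcome k K G → (K , G) ∈ outcomes n k
∈-outcomes⁺ {k = k} {K} {G} o = ∈-filter⁺ (T? ∘ _)
  (∈-cartesianProduct⁺ (∈-allSubsets K)
    (∈-filter⁺ (T? ∘ isSimpleGraph) (∈-allVecs _ G (∈-allSubsets ∘ lookup G)) simple))
  (Equivalence.from T-∧ (≡⇒≡ᵇ ∣ K ∣ k size , clique))
  where open IsOutcome o

overwrite-isOutcome : ∀ {k} {G : Graph n} {K} {σ : Vec (Fin n) s} {τ : Vec (Fin n) t} {P} →
  Biclique G K σ τ → IsOutcome k K G → IsOutcome k K (Overwrite.overwrite σ τ G P)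
overwrite-isOutcome {G = G} {K} {σ} {τ} {P} b o = record
  { size   = size
  ; clique = subst T (sym (isClique-cong (overwrite G P) G K λ i j i∈K j∈K →
               adj-overwrite-outside G P (τ-avoids {i} i∈K) (τ-avoids {j} j∈K))) clique
  ; simple = isSimpleGraph⁺ (overwrite G P) (overwrite-loopless disjoint {G} P loopless)
                                            (overwrite-symmetric disjoint {G} P symmetric)
  }
  where
  open Overwrite σ τ
  open IsOutcome o
  open Biclique b

outcomes-unique : (n k : ℕ) → Unique (outcomes n k)
outcomes-unique n k = Unique.filter⁺ _ (Unique.cartesianProduct⁺ (allSubsets-unique n)
  (Unique.filter⁺ _ (allVecs-unique n (allSubsets-unique n))))

Pattern : ℕ → ℕ → Set
Pattern s t = Vec (Vec Bool t) s

entry : Pattern s t → Fin s → Fin t → Bool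
entry P i j = lookup (lookup P i) j

-- v₀ is a junk value: it pads σ and τ only on outcomes that are not bad, where they are never used.
module Encoding (n k : ℕ) (v₀ : Fin n) where

  s₀ t₀ : ℕ
  s₀ = ⌈log₂ (n ^ 2) ⌉
  t₀ = ⌈log₂ (suc (k ^ 3)) ⌉

  -- The predicate of badEvent, so that badEvent n k G K is any (isBadSet G K) (allSubsets n).
  isBadSet : Graph n → Subset n → Subset n → Bool
  isBadSet G K S = (S ⊆ᵇ K) ∧ ((n ^ 2) ≤ᵇ (2 ^ ∣ S ∣)) ∧ not ((2 ^ ∣ commonNbrsOutside G K S ∣) ≤ᵇ (k ^ 3))

  badSet : Subset n → Graph n → Subset n
  badSet K G = firstOr ⊥ (isBadSet G K) (allSubsets n)

  σ : Subset n → Graph n → Vec (Fin n) s₀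
  σ K G = takeOr v₀ s₀ (elements (badSet K G))

  τ : Subset n → Graph n → Vec (Fin n) t₀
  τ K G = takeOr v₀ t₀ (elements (commonNbrsOutside G K (badSet K G)))

  bad⇒biclique : ∀ {G K} → T (badEvent n k G K) → Biclique G K (σ K G) (τ K G)
  bad⇒biclique {G} {K} bad
    with S⊆K , large , many ← T-∧₃ {badSet K G ⊆ᵇ K} (firstOr-satisfies ⊥ (isBadSet G K) (allSubsets n) bad)
    = biclique-of-commonNbrsOutside v₀ G K (badSet K G) (⊆ᵇ⇒⊆ (badSet K G) K S⊆K)
        (⌈log₂⌉-least (≤ᵇ⇒≤ (n ^ 2) _ large)) (⌈log₂⌉-least (not-≤ᵇ⇒> _ (k ^ 3) many))

  Code : Set
  Code = Vec (Fin n) s₀ × Vec (Fin n) t₀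

  codes : Subset n → List Code
  codes K = cartesianProduct (allVecs (elements K) s₀) (allVecs (allFin n) t₀)

  badOutcomes : List (Subset n × Graph n)
  badOutcomes = filterᵇ (λ o → badEvent n k (proj₂ o) (proj₁ o)) (outcomes n k)

  patterns : List (Pattern s₀ t₀)
  patterns = allVecs (allSubsets t₀) s₀

  encodable : List ((Subset n × Graph n) × Pattern s₀ t₀)
  encodable = cartesianProduct badOutcomes patterns

  codedOutcomes : List ((Subset n × Graph n) × Code)
  codedOutcomes = dependentProduct (outcomes n k) (codes ∘ proj₁)

  encode : (Subset n × Graph n) × Pattern s₀ t₀ → (Subset n × Graph n) × Code
  encode ((K , G) , P) = (K , Overwrite.overwrite (σ K G) (τ K G) G (entry P)) , (σ K G , τ K G)

  ∈-encodable⁻ : ∀ {K G P} → ((K , G) , P) ∈ encodable → IsOutcome k K G × Biclique G K (σ K G) (τ K G)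
  ∈-encodable⁻ x∈ with o∈ , bad ← ∈-filter⁻ (T? ∘ _) (proj₁ (∈-cartesianProduct⁻ badOutcomes _ x∈))
    = ∈-outcomes⁻ o∈ , bad⇒biclique bad

  encode-∈ : ∀ {x} → x ∈ encodable → encode x ∈ codedOutcomes
  encode-∈ {(K , G) , P} x∈ with o , b ← ∈-encodable⁻ x∈ =
    ∈-dependentProduct⁺ (∈-outcomes⁺ (overwrite-isOutcome b o)) (∈-cartesianProduct⁺
      (∈-allVecs _ _ (∈-elements⁺ K ∘ Biclique.inside b)) (∈-allVecs _ _ (∈-allFin ∘ _)))

  encode-injective : ∀ {x y} → x ∈ encodable → y ∈ encodable → encode x ≡ encode y → x ≡ y
  encode-injective {(K , G) , P} {(K′ , G′) , P′} x∈ y∈ e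
    with refl ← cong (proj₁ ∘ proj₁) e
    with o , b ← ∈-encodable⁻ x∈ | o′ , b′ ← ∈-encodable⁻ y∈
    with G≡G′ , P≗P′ ← overwrite-injective b b′ (IsOutcome.symmetric o) (IsOutcome.symmetric o′)
                         (cong (proj₁ ∘ proj₂) e) (cong (proj₂ ∘ proj₂) e) (cong (proj₂ ∘ proj₁) e)
    = cong₂ _,_ (cong (K ,_) G≡G′) (matrix-ext P≗P′)

  length-codes : ∀ {K} → ∣ K ∣ ≡ k → length (codes K) ≡ k ^ s₀ * n ^ t₀
  length-codes {K} size = trans (length-cartesianProduct (allVecs (elements K) s₀) (allVecs (allFin n) t₀))
    (cong₂ _*_ (trans (length-allVecs (elements K) s₀) (cong (_^ s₀) (trans (length-elements K) size)))
               (trans (length-allVecs (allFin n) t₀) (cong (_^ t₀) (length-tabulate {A = Fin n} id))))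

  counting : badCount n k * (2 ^ t₀) ^ s₀ ≤ totalCount n k * (k ^ s₀ * n ^ t₀)
  counting = begin
    badCount n k * (2 ^ t₀) ^ s₀       ≡⟨ cong (badCount n k *_) length-patterns ⟨
    badCount n k * length patterns     ≡⟨ length-cartesianProduct badOutcomes patterns ⟨
    length encodable                   ≤⟨ injectiveOn⇒length≤ encodable-unique encode encode-∈ encode-injective ⟩
    length codedOutcomes               ≡⟨ length-dependentProduct (outcomes n k) _ _ length-codes-of-outcome ⟩
    totalCount n k * (k ^ s₀ * n ^ t₀) ∎
    where
    open ≤-Reasoning
    length-patterns : length patterns ≡ (2 ^ t₀) ^ s₀
    length-patterns = trans (length-allVecs _ s₀) (cong (_^ s₀) (length-allSubsets t₀))
    length-codes-of-outcome : ∀ {o} → o ∈ outcomes n k → length (codes (proj₁ o)) ≡ k ^ s₀ * n ^ t₀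
    length-codes-of-outcome {K , G} o∈ = length-codes {K} (IsOutcome.size (∈-outcomes⁻ o∈))
    encodable-unique : Unique encodable
    encodable-unique = Unique.cartesianProduct⁺ (Unique.filter⁺ _ (outcomes-unique n k))
      (allVecs-unique s₀ (allSubsets-unique t₀))

^-distribʳ-* : ∀ m n o → (m * n) ^ o ≡ m ^ o * n ^ o
^-distribʳ-* m n zero    = refl
^-distribʳ-* m n (suc o) = trans (cong (m * n *_) (^-distribʳ-* m n o)) (interchange m n (m ^ o) (n ^ o))
  where
  interchange : ∀ a b c d → a * b * (c * d) ≡ a * c * (b * d)
  interchange = solve-∀

raise-^≤^ : ∀ {x y} a b c → x ^ a ≤ y ^ b → x ^ (a * c) ≤ y ^ (b * c)
raise-^≤^ {x} {y} a b c h = begin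
  x ^ (a * c)  ≡⟨ ^-*-assoc x a c ⟨
  (x ^ a) ^ c  ≤⟨ ^-monoˡ-≤ c h ⟩
  (y ^ b) ^ c  ≡⟨ ^-*-assoc y b c ⟩
  y ^ (b * c)  ∎
  where open ≤-Reasoning

trans-^≤^ : ∀ {x y z} a b c d → x ^ a ≤ y ^ b → y ^ c ≤ z ^ d → x ^ (a * c) ≤ z ^ (b * d)
trans-^≤^ {x} {y} {z} a b c d h₁ h₂ = begin
  x ^ (a * c)  ≤⟨ raise-^≤^ a b c h₁ ⟩
  y ^ (b * c)  ≡⟨ cong (y ^_) (*-comm b c) ⟩
  y ^ (c * b)  ≤⟨ raise-^≤^ c d b h₂ ⟩
  z ^ (d * b)  ≡⟨ cong (z ^_) (*-comm d b) ⟩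
  z ^ (b * d)  ∎
  where open ≤-Reasoning

^2-cancel-≤ : ∀ {m n} → m ^ 2 ≤ n ^ 2 → m ≤ n
^2-cancel-≤ h = ≮⇒≥ (λ n<m → <⇒≱ (^-monoˡ-< 2 n<m) h)

-- Exponents 1/6 + 1/3 + 1/2 = 1: e ≤ w^(1/6), x ≤ w^(1/3), y ≤ w^(1/2).
product-≤-of-roots : ∀ e x y w → e ^ 2 ≤ x → x ^ 3 ≤ w → y ^ 2 ≤ w → e * x * y ≤ w
product-≤-of-roots e x y w e²≤x x³≤w y²≤w = ^2-cancel-≤ (begin
  (e * x * y) ^ 2        ≡⟨ trans (^-distribʳ-* (e * x) y 2) (cong (_* y ^ 2) (^-distribʳ-* e x 2)) ⟩
  e ^ 2 * x ^ 2 * y ^ 2  ≤⟨ *-monoˡ-≤ (y ^ 2) (*-monoˡ-≤ (x ^ 2) e²≤x) ⟩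
  x ^ 3 * y ^ 2          ≤⟨ *-mono-≤ x³≤w y²≤w ⟩
  w * w                  ≡⟨ cong (w *_) (*-identityʳ w) ⟨
  w ^ 2                  ∎)
  where open ≤-Reasoning

cancel-power : ∀ {B T W M} E X .{{_ : NonZero M}} → B * W ≤ T * M → E * M ^ X ≤ W ^ X → B ^ X * E ≤ T ^ X
cancel-power {B} {T} {W} {M} E X BW≤TM key = *-cancelʳ-≤ (B ^ X * E) (T ^ X) (M ^ X) {{m^n≢0 M X}} (begin
  B ^ X * E * M ^ X    ≡⟨ *-assoc (B ^ X) E (M ^ X) ⟩
  B ^ X * (E * M ^ X)  ≤⟨ *-monoʳ-≤ (B ^ X) key ⟩
  B ^ X * W ^ X        ≡⟨ ^-distribʳ-* B W X ⟨
  (B * W) ^ X          ≤⟨ ^-monoˡ-≤ X BW≤TM ⟩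
  (T * M) ^ X          ≡⟨ ^-distribʳ-* T M X ⟩
  T ^ X * M ^ X        ∎)
  where open ≤-Reasoning

probability-bound : ∀ {bad total n k s t} .{{_ : NonZero n}} .{{_ : NonZero k}} →
  n ^ 2 ≤ 2 ^ s → k ^ 3 ≤ 2 ^ t → bad * (2 ^ t) ^ s ≤ total * (k ^ s * n ^ t) →
  ProbAtMostInvNPowLogK bad total n k
probability-bound {n = n} {k} {s} {t} n²≤2^s k³≤2^t counting a b c d _ _ 2^a≤n^b 2^c≤k^d =
  cancel-power (2 ^ (a * c)) X {{m*n≢0 (k ^ s) (n ^ t) {{m^n≢0 k s}} {{m^n≢0 n t}}}} counting (begin
    2 ^ (a * c) * (k ^ s * n ^ t) ^ X            ≡⟨ cong (2 ^ (a * c) *_) (^-distribʳ-* (k ^ s) (n ^ t) X) ⟩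
    2 ^ (a * c) * ((k ^ s) ^ X * (n ^ t) ^ X)    ≡⟨ cong (2 ^ (a * c) *_) (cong₂ _*_ (^-*-assoc k s X) (^-*-assoc n t X)) ⟩
    2 ^ (a * c) * (k ^ (s * X) * n ^ (t * X))    ≡⟨ *-assoc (2 ^ (a * c)) _ _ ⟨
    2 ^ (a * c) * k ^ (s * X) * n ^ (t * X)      ≤⟨ product-≤-of-roots (2 ^ (a * c)) _ (n ^ (t * X)) _ e²≤x x³≤w y²≤w ⟩
    2 ^ (t * (s * X))                            ≡⟨ trans (^-*-assoc (2 ^ t) s X) (^-*-assoc 2 t (s * X)) ⟨
    ((2 ^ t) ^ s) ^ X                            ∎)
  where
  open ≤-Reasoning
  X : ℕ
  X = b * d
  e²≤x : (2 ^ (a * c)) ^ 2 ≤ k ^ (s * X)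
  e²≤x = begin
    (2 ^ (a * c)) ^ 2  ≡⟨ ^-*-assoc 2 (a * c) 2 ⟩
    2 ^ (a * c * 2)    ≡⟨ cong (2 ^_) (reorder a c) ⟩
    2 ^ (a * 2 * c)    ≤⟨ trans-^≤^ (a * 2) (b * s) c d (trans-^≤^ a b 2 s 2^a≤n^b n²≤2^s) 2^c≤k^d ⟩
    k ^ (b * s * d)    ≡⟨ cong (k ^_) (regroup b s d) ⟩
    k ^ (s * X)        ∎
    where
    reorder : ∀ a c → a * c * 2 ≡ a * 2 * c
    reorder = solve-∀
    regroup : ∀ b s d → b * s * d ≡ s * (b * d)
    regroup = solve-∀
  x³≤w : (k ^ (s * X)) ^ 3 ≤ 2 ^ (t * (s * X))
  x³≤w = begin
    (k ^ (s * X)) ^ 3  ≡⟨ ^-*-assoc k (s * X) 3 ⟩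
    k ^ (s * X * 3)    ≡⟨ cong (k ^_) (*-comm (s * X) 3) ⟩
    k ^ (3 * (s * X))  ≤⟨ raise-^≤^ 3 t (s * X) k³≤2^t ⟩
    2 ^ (t * (s * X))  ∎
  y²≤w : (n ^ (t * X)) ^ 2 ≤ 2 ^ (t * (s * X))
  y²≤w = begin
    (n ^ (t * X)) ^ 2  ≡⟨ ^-*-assoc n (t * X) 2 ⟩
    n ^ (t * X * 2)    ≡⟨ cong (n ^_) (*-comm (t * X) 2) ⟩
    n ^ (2 * (t * X))  ≤⟨ raise-^≤^ 2 s (t * X) n²≤2^s ⟩
    2 ^ (s * (t * X))  ≡⟨ cong (2 ^_) (swap s t X) ⟩
    2 ^ (t * (s * X))  ∎
    where
    swap : ∀ s t x → s * (t * x) ≡ t * (s * x)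
    swap = solve-∀

lemma5 : (n k : ℕ) → 1 ≤ k → k ≤ n → n ^ 2 ≤ 2 ^ k →
    ProbAtMostInvNPowLogK (badCount n k) (totalCount n k) n k
lemma5 zero    (suc k) _ () _
lemma5 (suc n) (suc k) _ _  _ = probability-bound {s = s₀} {t₀}
  (n≤2^⌈log₂n⌉ (suc n ^ 2)) (<⇒≤ (n≤2^⌈log₂n⌉ (suc (suc k ^ 3)))) counting
  where open Encoding (suc n) (suc k) zero
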